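{- Let \(\mathcal V\) be a universe, \((X,\sqsubseteq)\) a locally small \(\delta_{\mathcal V}\)-complete poset and \(x,y:X\) with \(x\sqsubseteq y\). Let \(\Delta_{x,y}:\Omega_{\mathcal V}\to X\) be \(P\mapsto\bigvee\delta_{x,y,P}\). Then \(x\neq y\) (i.e. \(X\) is nontrivial, witnessed by \(x,y\)) if and only if the composite \(\Omega^{\neg\neg}_{\mathcal V}\hookrightarrow\Omega_{\mathcal V}\xrightarrow{\Delta_{x,y}}X\) is a section, i.e. has a left inverse \(r:X\to\Omega^{\neg\neg}_{\mathcal V}\).
   Context: Setting: intensional Martin-Löf type theory with universes, function extensionality, propositional extensionality, propositional truncation. A proposition is a type with at most one element; \(\Omega_{\mathcal V}\) is the type of propositions in \(\mathcal V\); \(\Omega^{\neg\neg}_{\mathcal V}\) is its subtype of propositions \(P\) with \(\neg\neg P\to P\), and the first map is the inclusion. A poset is a type with a proposition-valued reflexive, transitive, antisymmetric relation \(\sqsubseteq\). For \(x\sqsubseteq y\) and a proposition \(P:\mathcal V\), \(\delta_{x,y,P}:\mathbf 1+P\to X\) sends \(\mathrm{inl}(\star)\mapsto x\), \(\mathrm{inr}(p)\mapsto y\); the poset is \(\delta_{\mathcal V}\)-complete if all such families have suprema \(\bigvee\delta_{x,y,P}\). Locally small: there is \(\sqsubseteq_{\mathcal V}:X\to X\to\mathcal V\) with \((a\sqsubseteq b)\simeq(a\sqsubseteq_{\mathcal V}b)\) for all \(a,b\). A map \(s\) is a section if there is \(r\) with \(r\circ s\sim\mathrm{id}\). -}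

module Defs where

open import Level using (Level; _⊔_; suc; Setω)
open import Data.Unit using (⊤; tt)
open import Data.Sum using (_⊎_; inj₁; inj₂)
open import Data.Product using (Σ; _×_; _,_; proj₁; proj₂)
open import Relation.Nullary using (¬_)
open import Relation.Binary.PropositionalEquality using (_≡_)
open import Function.Bundles using (_↔_)

isProp : ∀ {ℓ} → Set ℓ → Set ℓ
isProp A = (a b : A) → a ≡ b

FunExt : Setω
FunExt = ∀ {a b} {A : Set a} {B : A → Set b} {f g : (x : A) → B x}
       → (∀ x → f x ≡ g x) → f ≡ g

PropExt : Setω
PropExt = ∀ {ℓ} {P Q : Set ℓ} → isProp P → isProp Q → (P → Q) → (Q → P) → P ≡ Q

Ω : (𝓥 : Level) → Set (suc 𝓥)
Ω 𝓥 = Σ (Set 𝓥) isProp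

Ω¬¬ : (𝓥 : Level) → Set (suc 𝓥)
Ω¬¬ 𝓥 = Σ (Ω 𝓥) (λ P → ¬ ¬ (proj₁ P) → proj₁ P)

incl : ∀ {𝓥} → Ω¬¬ 𝓥 → Ω 𝓥
incl = proj₁

record Poset (𝓤 𝓣 : Level) : Set (suc (𝓤 ⊔ 𝓣)) where
  field
    Carrier   : Set 𝓤
    _⊑_       : Carrier → Carrier → Set 𝓣
    ⊑-prop    : ∀ x y → isProp (x ⊑ y)
    ⊑-refl    : ∀ x → x ⊑ x
    ⊑-trans   : ∀ x y z → x ⊑ y → y ⊑ z → x ⊑ z
    ⊑-antisym : ∀ x y → x ⊑ y → y ⊑ x → x ≡ y

module _ {𝓤 𝓣 : Level} (𝑷 : Poset 𝓤 𝓣) where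
  open Poset 𝑷

  isSup : ∀ {i} {I : Set i} → (I → Carrier) → Carrier → Set (𝓤 ⊔ 𝓣 ⊔ i)
  isSup α s = (∀ i → α i ⊑ s) × (∀ u → (∀ i → α i ⊑ u) → s ⊑ u)

  δ : ∀ {𝓥} (x y : Carrier) (P : Set 𝓥) → ⊤ ⊎ P → Carrier
  δ x y P (inj₁ _) = x
  δ x y P (inj₂ _) = y

  δ-complete : (𝓥 : Level) → Set (𝓤 ⊔ 𝓣 ⊔ suc 𝓥)
  δ-complete 𝓥 = ∀ x y → x ⊑ y → (P : Ω 𝓥) → Σ Carrier (isSup (δ x y (proj₁ P)))

  locally-small : (𝓥 : Level) → Set (𝓤 ⊔ 𝓣 ⊔ suc 𝓥)
  locally-small 𝓥 = Σ (Carrier → Carrier → Set 𝓥) (λ _⊑ᵥ_ → ∀ a b → (a ⊑ b) ↔ (a ⊑ᵥ b))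

  Δ : ∀ {𝓥} → δ-complete 𝓥 → (x y : Carrier) → x ⊑ y → Ω 𝓥 → Carrier
  Δ c x y l P = proj₁ (c x y l P)

is-section : ∀ {a b} {A : Set a} {B : Set b} → (A → B) → Set (a ⊔ b)
is-section {A = A} {B} s = Σ (B → A) (λ r → ∀ a → r (s a) ≡ a)

{-# OPTIONS --safe #-}
-- If x ≠ y, then ¬ (Δ P ⊑ x) holds exactly when P does, for every ¬¬-stable P:
-- a witness of P forces y ⊑ Δ P, so Δ P ⊑ x would give x = y, while ¬ P makes
-- x an upper bound of δ_{x,y,P}.  Local smallness turns P ↦ ¬ (Δ P ⊑ x) into a
-- map X → Ω¬¬ in the universe V, which is the required retraction.
-- Conversely, if x = y then Δ is constant, so a retraction would identify the
-- true and the false ¬¬-stable propositions.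
module Submission where

open import Defs
open import Level using (Level)
open import Data.Product using (Σ; _×_; _,_; proj₁; proj₂)
open import Data.Unit.Polymorphic using (⊤; tt)
open import Data.Empty using (⊥-elim)
import Data.Empty.Polymorphic as Polymorphic
open import Data.Sum using (inj₁; inj₂)
open import Relation.Nullary using (¬_)
open import Relation.Binary.PropositionalEquality
  using (_≡_; refl; sym; trans; cong; subst)
open import Axiom.UniquenessOfIdentityProofs using (UIP; module Constant⇒UIP)
open import Function.Base using (_∘_)
open import Function.Bundles using (Inverse)

private
  variable
    ℓ : Level

isProp⇒UIP : {A : Set ℓ} → isProp A → UIP A
isProp⇒UIP {A = A} A-prop = Constant⇒UIP.≡-irrelevant canonical (λ _ _ → refl)
  where
  canonical : {a b : A} → a ≡ b → a ≡ b
  canonical {a} {b} _ = A-prop a b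

isProp-isProp : FunExt → {A : Set ℓ} → isProp (isProp A)
isProp-isProp fe p q = fe λ a → fe λ b → isProp⇒UIP p (p a b) (q a b)

isProp-¬ : FunExt → {A : Set ℓ} → isProp (¬ A)
isProp-¬ fe f g = fe λ a → ⊥-elim (f a)

Σ-≡-isProp : ∀ {a b} {A : Set a} {B : A → Set b} → (∀ a → isProp (B a))
           → {u v : Σ A B} → proj₁ u ≡ proj₁ v → u ≡ v
Σ-≡-isProp B-prop {a , b} {.a , b′} refl = cong (a ,_) (B-prop a b b′)

Ω¬¬-≡ : FunExt → PropExt → (P Q : Ω¬¬ ℓ)
      → (proj₁ (incl P) → proj₁ (incl Q)) → (proj₁ (incl Q) → proj₁ (incl P)) → P ≡ Q
Ω¬¬-≡ fe pe ((P , P-prop) , _) ((Q , Q-prop) , _) to from =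
  Σ-≡-isProp (λ (R , R-prop) _ _ → fe λ _ → R-prop _ _)
    (Σ-≡-isProp (λ _ → isProp-isProp fe) (pe P-prop Q-prop to from))

¬-Ω¬¬ : FunExt → Set ℓ → Ω¬¬ ℓ
¬-Ω¬¬ fe A = ((¬ A) , isProp-¬ fe) , λ ¬¬¬A a → ¬¬¬A (λ ¬A → ¬A a)

⊤-Ω¬¬ : Ω¬¬ ℓ
⊤-Ω¬¬ = (⊤ , λ _ _ → refl) , λ _ → tt

⊥-Ω¬¬ : Ω¬¬ ℓ
⊥-Ω¬¬ = (Polymorphic.⊥ , λ ()) , λ ¬¬⊥ → ⊥-elim (¬¬⊥ λ ())

⊤-Ω¬¬≢⊥-Ω¬¬ : ¬ (⊤-Ω¬¬ {ℓ} ≡ ⊥-Ω¬¬)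
⊤-Ω¬¬≢⊥-Ω¬¬ eq with subst (proj₁ ∘ incl) eq tt
... | ()

section⇒injective : ∀ {a b} {A : Set a} {B : Set b} {s : A → B}
                  → is-section s → ∀ {a₁ a₂} → s a₁ ≡ s a₂ → a₁ ≡ a₂
section⇒injective (r , r∘s≗id) {a₁} {a₂} eq =
  trans (sym (r∘s≗id a₁)) (trans (cong r eq) (r∘s≗id a₂))

module _ {𝓤 𝓣 𝓥 : Level} (𝑷 : Poset 𝓤 𝓣) (c : δ-complete 𝑷 𝓥) where
  open Poset 𝑷

  module _ {x y : Carrier} (x⊑y : x ⊑ y) where

    private
      Δxy : Ω 𝓥 → Carrier
      Δxy = Δ 𝑷 c x y x⊑y

    x⊑Δ : ∀ P → x ⊑ Δxy P
    x⊑Δ P = proj₁ (proj₂ (c x y x⊑y P)) (inj₁ _)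

    y⊑Δ : ∀ P → proj₁ P → y ⊑ Δxy P
    y⊑Δ P p = proj₁ (proj₂ (c x y x⊑y P)) (inj₂ p)

    Δ-least : ∀ P u → x ⊑ u → (proj₁ P → y ⊑ u) → Δxy P ⊑ u
    Δ-least P u x⊑u y⊑u = proj₂ (proj₂ (c x y x⊑y P)) u λ where
      (inj₁ _) → x⊑u
      (inj₂ p) → y⊑u p

    Δ≡y-if-x≡y : x ≡ y → ∀ P → Δxy P ≡ y
    Δ≡y-if-x≡y x≡y P = ⊑-antisym _ _
      (Δ-least P y x⊑y (λ _ → ⊑-refl y))
      (subst (_⊑ Δxy P) x≡y (x⊑Δ P))

    Δ⊑x-if-¬P : ∀ P → ¬ proj₁ P → Δxy P ⊑ x
    Δ⊑x-if-¬P P ¬p = Δ-least P x (⊑-refl x) (λ p → ⊥-elim (¬p p))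

    x≡y-if-P-and-Δ⊑x : ∀ P → proj₁ P → Δxy P ⊑ x → x ≡ y
    x≡y-if-P-and-Δ⊑x P p Δ⊑x = ⊑-antisym x y x⊑y (⊑-trans y (Δxy P) x (y⊑Δ P p) Δ⊑x)

    Δ∘incl-section : FunExt → PropExt → locally-small 𝑷 𝓥
                   → ¬ (x ≡ y) → is-section (Δxy ∘ incl {𝓥})
    Δ∘incl-section fe pe (_⊑ᵥ_ , ⊑↔⊑ᵥ) x≢y = r , r∘Δ≗id
      where
      r : Carrier → Ω¬¬ 𝓥
      r z = ¬-Ω¬¬ fe (z ⊑ᵥ x)

      r∘Δ≗id : ∀ P → r (Δxy (incl P)) ≡ P
      r∘Δ≗id P@(P′ , ¬¬-stable) = Ω¬¬-≡ fe pe (r (Δxy P′)) P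
        (λ Δ⋢x → ¬¬-stable λ ¬p → Δ⋢x (Inverse.to (⊑↔⊑ᵥ _ _) (Δ⊑x-if-¬P P′ ¬p)))
        (λ p Δ⊑x → x≢y (x≡y-if-P-and-Δ⊑x P′ p (Inverse.from (⊑↔⊑ᵥ _ _) Δ⊑x)))

    Δ∘incl-section⇒x≢y : is-section (Δxy ∘ incl {𝓥}) → ¬ (x ≡ y)
    Δ∘incl-section⇒x≢y section x≡y = ⊤-Ω¬¬≢⊥-Ω¬¬ (section⇒injective section
      (trans (Δ≡y-if-x≡y x≡y (incl ⊤-Ω¬¬)) (sym (Δ≡y-if-x≡y x≡y (incl ⊥-Ω¬¬)))))

lemma3p20 : FunExt → PropExt → {𝓤 𝓣 : Level} (𝓥 : Level) (𝑷 : Poset 𝓤 𝓣)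
    → locally-small 𝑷 𝓥 → (c : δ-complete 𝑷 𝓥)
    → (x y : Poset.Carrier 𝑷) (l : Poset._⊑_ 𝑷 x y)
    → (¬ (x ≡ y) → is-section (Δ 𝑷 c x y l ∘ incl {𝓥}))
    × (is-section (Δ 𝑷 c x y l ∘ incl {𝓥}) → ¬ (x ≡ y))
lemma3p20 fe pe 𝓥 𝑷 ls c x y l =
  Δ∘incl-section 𝑷 c l fe pe ls , Δ∘incl-section⇒x≢y 𝑷 c l
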